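{- Let $n \geq 3$ be an integer and let $v_1, \dots, v_{2^{n-1}} \in \mathbb{F}_2^n$ be nonzero vectors (not necessarily distinct) with $\sum_{i=1}^{2^{n-1}} v_i = 0$ and $\dim(\mathrm{span}\{v_1, \dots, v_{2^{n-1}}\}) < n$. Then the index set $\{1, \dots, 2^{n-1}\}$ can be partitioned into two sets $A$ and $B$ with $|A| = |B| = 2^{n-2}$ such that $\sum_{i \in A} v_i = 0$ and $\sum_{i \in B} v_i = 0$. -}

module Defs where

open import Data.Bool using (Bool; true; false; _xor_; if_then_else_)
open import Data.Nat using (ℕ; zero; suc; _<_; _^_)
open import Data.Fin using (Fin)
open import Data.Vec using (Vec; replicate; zipWith; foldr; map; tabulate; count)
open import Data.List using (List; length)
import Data.List as L
open import Data.Product using (∃; ∃-syntax; _×_)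
open import Relation.Binary.PropositionalEquality using (_≡_; _≢_)
open import Relation.Nullary using (Dec)
open import Data.Bool using (T)
open import Data.List.Membership.Propositional using (_∈_)

F₂^ : ℕ → Set
F₂^ n = Vec Bool n

zeroV : ∀ {n} → F₂^ n
zeroV = replicate _ false

_⊕_ : ∀ {n} → F₂^ n → F₂^ n → F₂^ n
_⊕_ = zipWith _xor_

Σᵥ : ∀ {n m} → (Fin m → F₂^ n) → F₂^ n
Σᵥ {m = m} v = foldr _ _⊕_ zeroV (tabulate v)

ΣOver : ∀ {n m} → (Fin m → Bool) → (Fin m → F₂^ n) → F₂^ n
ΣOver S v = Σᵥ (λ i → if S i then v i else zeroV)

card : ∀ {m} → (Fin m → Bool) → ℕ
card S = count (λ b → Data.Bool._≟_ b true) (tabulate S)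

ΣL : ∀ {n} → List (F₂^ n) → F₂^ n
ΣL = L.foldr _⊕_ zeroV

-- span of a list of vectors over F₂: all F₂-linear combinations,
-- i.e. all sums of sub-selections (coefficients in F₂ = Bool)
InSpan : ∀ {n} → List (F₂^ n) → F₂^ n → Set
InSpan ws x = ∃[ c ] (length c ≡ length ws) ×
  (ΣL (L.zipWith (λ b w → if b then w else zeroV) c ws) ≡ x)

-- dim(span{v_1..v_m}) < k : the span of the v_i is spanned by fewer than k vectors
-- (dimension = minimal size of a spanning set).
DimSpan< : ∀ {n m} → (Fin m → F₂^ n) → ℕ → Set
DimSpan< {n} {m} v k = ∃[ ws ] (length ws < k) ×
  ((x : F₂^ n) → (∃[ S ] ΣOver S v ≡ x) → InSpan ws x) ×
  ((w : F₂^ n) → w ∈ ws → ∃[ S ] ΣOver S v ≡ w)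

module Submission where

-- Let m = 2^(n-1) = 2k nonzero vectors of F₂ⁿ have sum 0 and span a space spanned
-- by fewer than n vectors, so their subset sums take at most m values.  We build a
-- zero-sum set A of k indices; its complement then has k elements and sum 0.
-- Key step: any set R of at least k + 4 indices contains a zero-sum quadruple.
-- Either R holds two disjoint pairs of equal vectors, or after removing at most
-- one such pair v is injective on a set D with |D| ≥ k + 2.  Then pick x ≠ y in D,
-- put t = v x + v y and D′ = D ∖ {x, y}: the |D| + |D′| > 2k values v i (i ∈ D)
-- and v j + t (j ∈ D′) must collide, and the only possible collision
-- v i = v j + t makes {x, y, i, j} a zero-sum quadruple.  Adding quadruples taken
-- from the complement of the set built so far gives A when 4 ∣ k (n ≥ 4); for
-- n = 3 the values 0, v₁, …, v₄ collide, so two of the vectors coincide.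

open import Defs
open import Level using (0ℓ)
open import Function using (id; _∘_)
open import Function.Bundles using (Equivalence)
open import Algebra.Bundles using (AbelianGroup)
open import Algebra.Structures using (IsAbelianGroup)
import Algebra.Properties.AbelianGroup as AbelianGroupProperties
import Algebra.Properties.CommutativeSemigroup as CommutativeSemigroupProperties
open import Data.Bool using (Bool; true; false; not; _∧_; _∨_; if_then_else_; T)
import Data.Bool.Properties as BP
open import Data.Nat using (ℕ; zero; suc; _+_; _*_; _≤_; _<_; _∸_; _^_; z≤n; s≤s)
import Data.Nat.Properties as NP
open import Data.Fin using (Fin; zero; suc; splitAt; join; fromℕ<; combine)
open import Data.Fin.Properties using (_≟_)
import Data.Fin.Properties as FP
open import Data.Vec using ([]; _∷_)
import Data.Vec.Properties as VP
open import Data.List using (List; []; _∷_; length)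
import Data.List as L
open import Data.Product using (_,_; _×_; ∃₂; ∃-syntax; proj₁; proj₂)
open import Data.Sum using (_⊎_; inj₁; inj₂; [_,_]′)
open import Data.Empty using (⊥-elim)
open import Relation.Nullary using (¬_; yes; no)
open import Relation.Nullary.Decidable using (does; ¬?; _×-dec_; decidable-stable; T?)
open import Relation.Binary.PropositionalEquality

⊕-self : ∀ {n} (x : F₂^ n) → x ⊕ x ≡ zeroV
⊕-self []      = refl
⊕-self (b ∷ x) = cong₂ _∷_ (BP.xor-same b) (⊕-self x)

⊕-isAbelianGroup : ∀ n → IsAbelianGroup _≡_ (_⊕_ {n}) zeroV id
⊕-isAbelianGroup n = record
  { isGroup = record
    { isMonoid = record
      { isSemigroup = record
        { isMagma = record { isEquivalence = isEquivalence ; ∙-cong = cong₂ _⊕_ }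
        ; assoc   = VP.zipWith-assoc BP.xor-assoc
        }
      ; identity = VP.zipWith-identityˡ BP.xor-identityˡ , VP.zipWith-identityʳ BP.xor-identityʳ
      }
    ; inverse = ⊕-self , ⊕-self
    ; ⁻¹-cong = id
    }
  ; comm = VP.zipWith-comm BP.xor-comm
  }

F₂ⁿ : ℕ → AbelianGroup 0ℓ 0ℓ
F₂ⁿ n = record { isAbelianGroup = ⊕-isAbelianGroup n }

module ⊕ {n : ℕ} where
  open AbelianGroup (F₂ⁿ n) public using (comm; identityˡ; identityʳ; inverseʳ; uniqueˡ-⁻¹)
  open AbelianGroupProperties (F₂ⁿ n) public using (∙-cancelˡ; ∙-cancelʳ; xyx⁻¹≈y)
  open CommutativeSemigroupProperties (AbelianGroup.commutativeSemigroup (F₂ⁿ n)) public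
    using (interchange)

⊕-solve : ∀ {n} {a b c : F₂^ n} → a ≡ b ⊕ c → a ⊕ b ≡ c
⊕-solve {b = b} {c} refl = ⊕.xyx⁻¹≈y b c

module ℕ+ = CommutativeSemigroupProperties NP.+-commutativeSemigroup

Subset : ℕ → Set
Subset m = Fin m → Bool

module _ {m : ℕ} where

  infix  4 _∈_ _⊆_
  infixr 6 _∪_
  infixl 7 _∖_

  _∈_ : Fin m → Subset m → Set
  i ∈ S = T (S i)

  _⊆_ : Subset m → Subset m → Set
  S ⊆ R = ∀ i → i ∈ S → i ∈ R

  ∅ full : Subset m
  ∅    _ = false
  full _ = true

  ⁅_⁆ : Fin m → Subset m
  ⁅ i ⁆ j = does (j ≟ i)

  pair : Fin m → Fin m → Subset m
  pair i j l = ⁅ i ⁆ l ∨ ⁅ j ⁆ l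

  _∪_ _∖_ : Subset m → Subset m → Subset m
  (S ∪ R) i = S i ∨ R i
  (S ∖ R) i = S i ∧ not (R i)

  -- S and R are disjoint exactly when S ⊆ ∁ R.
  ∁ : Subset m → Subset m
  ∁ S i = not (S i)

  ∉⇒∈∁ : (S : Subset m) (i : Fin m) → ¬ (i ∈ S) → i ∈ ∁ S
  ∉⇒∈∁ S i i∉S with S i
  ... | true  = i∉S _
  ... | false = _

  ∈∁⇒∉ : (S : Subset m) (i : Fin m) → i ∈ ∁ S → ¬ (i ∈ S)
  ∈∁⇒∉ S i i∈∁S i∈S with S i
  ... | true  = i∈∁S
  ... | false = i∈S

  ⁅⁆-∋ : (i : Fin m) → i ∈ ⁅ i ⁆
  ⁅⁆-∋ i with i ≟ i
  ... | yes _   = _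
  ... | no i≢i = i≢i refl

  ∈-⁅⁆ : (i j : Fin m) → j ∈ ⁅ i ⁆ → j ≡ i
  ∈-⁅⁆ i j j∈⁅i⁆ with j ≟ i
  ... | yes j≡i = j≡i
  ... | no _    = ⊥-elim j∈⁅i⁆

  ∉-⁅⁆ : (i j : Fin m) → j ≢ i → j ∈ ∁ ⁅ i ⁆
  ∉-⁅⁆ i j j≢i = ∉⇒∈∁ ⁅ i ⁆ j (j≢i ∘ ∈-⁅⁆ i j)

  ∪-⊆ : ∀ {S S′ R : Subset m} → S ⊆ R → S′ ⊆ R → S ∪ S′ ⊆ R
  ∪-⊆ {S} {S′} S⊆R S′⊆R i = [ S⊆R i , S′⊆R i ]′ ∘ Equivalence.to (BP.T-∨ {S i} {S′ i})

  pair-⊆ : ∀ {i j} {R : Subset m} → i ∈ R → j ∈ R → pair i j ⊆ R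
  pair-⊆ {i} {j} {R} i∈R j∈R = ∪-⊆ {⁅ i ⁆} {⁅ j ⁆} (singleton-⊆ i i∈R) (singleton-⊆ j j∈R)
    where
    singleton-⊆ : ∀ k → k ∈ R → ⁅ k ⁆ ⊆ R
    singleton-⊆ k k∈R l l∈⁅k⁆ = subst (_∈ R) (sym (∈-⁅⁆ k l l∈⁅k⁆)) k∈R

  pair-∋ˡ : (i j : Fin m) → i ∈ pair i j
  pair-∋ˡ i j = Equivalence.from BP.T-∨ (inj₁ (⁅⁆-∋ i))

  pair-∋ʳ : (i j : Fin m) → j ∈ pair i j
  pair-∋ʳ i j = Equivalence.from (BP.T-∨ {⁅ i ⁆ j}) (inj₂ (⁅⁆-∋ j))

  pair-∌ : (i j l : Fin m) → l ≢ i → l ≢ j → l ∈ ∁ (pair i j)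
  pair-∌ i j l l≢i l≢j = ∉⇒∈∁ (pair i j) l
    ([ l≢i ∘ ∈-⁅⁆ i l , l≢j ∘ ∈-⁅⁆ j l ]′ ∘ Equivalence.to (BP.T-∨ {⁅ i ⁆ l}))

  ∖-⊆ : ∀ {R S : Subset m} → R ∖ S ⊆ R
  ∖-⊆ {R} i = proj₁ ∘ Equivalence.to (BP.T-∧ {R i})

  ∖-⊆∁ : ∀ {R S : Subset m} → R ∖ S ⊆ ∁ S
  ∖-⊆∁ {R} i = proj₂ ∘ Equivalence.to (BP.T-∧ {R i})

  ∈-∖ : ∀ {i} {R S : Subset m} → i ∈ R → i ∈ ∁ S → i ∈ R ∖ S
  ∈-∖ i∈R i∈∁S = Equivalence.from BP.T-∧ (i∈R , i∈∁S)

  ∖-∪ : ∀ {S R : Subset m} → S ⊆ R → ∀ i → ((R ∖ S) ∪ S) i ≡ R i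
  ∖-∪ {S} {R} S⊆R i with R i | S i | S⊆R i
  ... | true  | true  | _    = refl
  ... | true  | false | _    = refl
  ... | false | true  | S⊆R′ = ⊥-elim (S⊆R′ _)
  ... | false | false | _    = refl

  ⁅⁆-disjoint : ∀ {i j : Fin m} → i ≢ j → ⁅ i ⁆ ⊆ ∁ ⁅ j ⁆
  ⁅⁆-disjoint {i} {j} i≢j l l∈⁅i⁆ = ∉-⁅⁆ j l (λ l≡j → i≢j (trans (sym (∈-⁅⁆ i l l∈⁅i⁆)) l≡j))

toℕ : Bool → ℕ
toℕ b = if b then 1 else 0

sel : ∀ {n} → Bool → F₂^ n → F₂^ n
sel b w = if b then w else zeroV

toℕ-∨ : ∀ a b → (T a → T (not b)) → toℕ (a ∨ b) ≡ toℕ a + toℕ b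
toℕ-∨ true  true  disjoint = ⊥-elim (disjoint _)
toℕ-∨ true  false _        = refl
toℕ-∨ false b     _        = refl

sel-∨ : ∀ {n} a b (w : F₂^ n) → (T a → T (not b)) → sel (a ∨ b) w ≡ sel a w ⊕ sel b w
sel-∨ true  true  w disjoint = ⊥-elim (disjoint _)
sel-∨ true  false w _        = sym (⊕.identityʳ w)
sel-∨ false b     w _        = sym (⊕.identityˡ (sel b w))

card-suc : ∀ {m} (S : Subset (suc m)) → card S ≡ toℕ (S zero) + card (S ∘ suc)
card-suc S with S zero
... | true  = refl
... | false = refl

card-∪ : ∀ {m} {S R : Subset m} → S ⊆ ∁ R → card (S ∪ R) ≡ card S + card R
card-∪ {zero}          _        = refl
card-∪ {suc m} {S} {R} disjoint = begin
  card (S ∪ R)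
    ≡⟨ card-suc (S ∪ R) ⟩
  toℕ (S zero ∨ R zero) + card (S ∘ suc ∪ R ∘ suc)
    ≡⟨ cong₂ _+_ (toℕ-∨ (S zero) (R zero) (disjoint zero)) (card-∪ {S = S ∘ suc} {R ∘ suc} (disjoint ∘ suc)) ⟩
  (toℕ (S zero) + toℕ (R zero)) + (card (S ∘ suc) + card (R ∘ suc))
    ≡⟨ ℕ+.interchange (toℕ (S zero)) (toℕ (R zero)) (card (S ∘ suc)) (card (R ∘ suc)) ⟩
  (toℕ (S zero) + card (S ∘ suc)) + (toℕ (R zero) + card (R ∘ suc))
    ≡⟨ cong₂ _+_ (card-suc S) (card-suc R) ⟨
  card S + card R ∎
  where open ≡-Reasoning

ΣOver-∪ : ∀ {n m} {S R : Subset m} (v : Fin m → F₂^ n) → S ⊆ ∁ R → ΣOver (S ∪ R) v ≡ ΣOver S v ⊕ ΣOver R v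
ΣOver-∪ {m = zero}          v _        = sym (⊕.identityˡ zeroV)
ΣOver-∪ {m = suc m} {S} {R} v disjoint = begin
  sel (S zero ∨ R zero) (v zero) ⊕ ΣOver (S ∘ suc ∪ R ∘ suc) (v ∘ suc)
    ≡⟨ cong₂ _⊕_ (sel-∨ (S zero) (R zero) (v zero) (disjoint zero))
                 (ΣOver-∪ {S = S ∘ suc} {R ∘ suc} (v ∘ suc) (disjoint ∘ suc)) ⟩
  (sel (S zero) (v zero) ⊕ sel (R zero) (v zero)) ⊕ (ΣOver (S ∘ suc) (v ∘ suc) ⊕ ΣOver (R ∘ suc) (v ∘ suc))
    ≡⟨ ⊕.interchange (sel (S zero) (v zero)) (sel (R zero) (v zero))
                     (ΣOver (S ∘ suc) (v ∘ suc)) (ΣOver (R ∘ suc) (v ∘ suc)) ⟩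
  ΣOver S v ⊕ ΣOver R v ∎
  where open ≡-Reasoning

card-cong : ∀ {m} {S R : Subset m} → (∀ i → S i ≡ R i) → card S ≡ card R
card-cong {zero}          _  = refl
card-cong {suc m} {S} {R} eq = begin
  card S                        ≡⟨ card-suc S ⟩
  toℕ (S zero) + card (S ∘ suc) ≡⟨ cong₂ _+_ (cong toℕ (eq zero)) (card-cong (eq ∘ suc)) ⟩
  toℕ (R zero) + card (R ∘ suc) ≡⟨ card-suc R ⟨
  card R                        ∎
  where open ≡-Reasoning

ΣOver-cong : ∀ {n m} {S R : Subset m} (v : Fin m → F₂^ n) → (∀ i → S i ≡ R i) → ΣOver S v ≡ ΣOver R v
ΣOver-cong {m = zero}  v _  = refl
ΣOver-cong {m = suc m} v eq =
  cong₂ _⊕_ (cong (λ b → sel b (v zero)) (eq zero)) (ΣOver-cong (v ∘ suc) (eq ∘ suc))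

card-∅ : ∀ {m} → card (∅ {m}) ≡ 0
card-∅ {zero}  = refl
card-∅ {suc m} = card-∅ {m}

card-full : ∀ {m} → card (full {m}) ≡ m
card-full {zero}  = refl
card-full {suc m} = cong suc (card-full {m})

ΣOver-∅ : ∀ {n m} (v : Fin m → F₂^ n) → ΣOver ∅ v ≡ zeroV
ΣOver-∅ {m = zero}  v = refl
ΣOver-∅ {m = suc m} v = trans (⊕.identityˡ _) (ΣOver-∅ (v ∘ suc))

card-⁅⁆ : ∀ {m} (i : Fin m) → card ⁅ i ⁆ ≡ 1
card-⁅⁆ {suc m} zero = cong suc (card-∅ {m})
card-⁅⁆ (suc i)      = card-⁅⁆ i

ΣOver-⁅⁆ : ∀ {n m} (v : Fin m → F₂^ n) (i : Fin m) → ΣOver ⁅ i ⁆ v ≡ v i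
ΣOver-⁅⁆ v zero    = trans (cong (v zero ⊕_) (ΣOver-∅ (v ∘ suc))) (⊕.identityʳ (v zero))
ΣOver-⁅⁆ v (suc i) = trans (⊕.identityˡ _) (ΣOver-⁅⁆ (v ∘ suc) i)

card-pair : ∀ {m} {i j : Fin m} → i ≢ j → card (pair i j) ≡ 2
card-pair {i = i} {j} i≢j =
  trans (card-∪ {S = ⁅ i ⁆} {⁅ j ⁆} (⁅⁆-disjoint i≢j)) (cong₂ _+_ (card-⁅⁆ i) (card-⁅⁆ j))

ΣOver-pair : ∀ {n m} {i j : Fin m} (v : Fin m → F₂^ n) → i ≢ j → ΣOver (pair i j) v ≡ v i ⊕ v j
ΣOver-pair {i = i} {j} v i≢j =
  trans (ΣOver-∪ {S = ⁅ i ⁆} {⁅ j ⁆} v (⁅⁆-disjoint i≢j)) (cong₂ _⊕_ (ΣOver-⁅⁆ v i) (ΣOver-⁅⁆ v j))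

card-∖ : ∀ {m} {S R : Subset m} → S ⊆ R → card (R ∖ S) + card S ≡ card R
card-∖ {S = S} {R} S⊆R = trans (sym (card-∪ {S = R ∖ S} {S} (∖-⊆∁ {R = R}))) (card-cong (∖-∪ S⊆R))

ΣOver-∖ : ∀ {n m} {S R : Subset m} (v : Fin m → F₂^ n) → S ⊆ R → ΣOver (R ∖ S) v ⊕ ΣOver S v ≡ ΣOver R v
ΣOver-∖ {S = S} {R} v S⊆R = trans (sym (ΣOver-∪ {S = R ∖ S} {S} v (∖-⊆∁ {R = R}))) (ΣOver-cong v (∖-∪ S⊆R))

card-∁ : ∀ {m} (S : Subset m) → card (∁ S) + card S ≡ m
card-∁ S = trans (card-∖ {S = S} {full} (λ _ _ → _)) card-full

ΣOver-∁ : ∀ {n m} (S : Subset m) (v : Fin m → F₂^ n) → ΣOver (∁ S) v ⊕ ΣOver S v ≡ Σᵥ v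
ΣOver-∁ S v = ΣOver-∖ {S = S} {full} v (λ _ _ → _)

-- An injective listing of the elements of S; it turns pigeonhole arguments
-- on subsets into pigeonhole arguments on Fin (card S).
record Enumeration {m} (S : Subset m) (c : ℕ) : Set where
  field
    element           : Fin c → Fin m
    element-∈         : ∀ a → element a ∈ S
    element-injective : ∀ a b → element a ≡ element b → a ≡ b

open Enumeration

enumerate : ∀ {m} (S : Subset m) → Enumeration S (card S)
enumerate {zero}  S = record { element = λ () ; element-∈ = λ () ; element-injective = λ () }
enumerate {suc m} S = subst (Enumeration S) (sym (card-suc S)) (extend (S zero) refl (enumerate (S ∘ suc)))
  where
  extend : ∀ b {c} → S zero ≡ b → Enumeration (S ∘ suc) c → Enumeration S (toℕ b + c)
  extend true S₀ E = record
    { element           = λ { zero → zero ; (suc a) → suc (element E a) }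
    ; element-∈         = λ { zero → subst T (sym S₀) _ ; (suc a) → element-∈ E a }
    ; element-injective = λ { zero    zero    _  → refl
                            ; zero    (suc _) ()
                            ; (suc _) zero    ()
                            ; (suc a) (suc b) eq → cong suc (element-injective E a b (FP.suc-injective eq)) }
    }
  extend false S₀ E = record
    { element           = suc ∘ element E
    ; element-∈         = element-∈ E
    ; element-injective = λ a b → element-injective E a b ∘ FP.suc-injective
    }

twoElements : ∀ {m} (S : Subset m) → 2 ≤ card S → ∃₂ λ i j → i ≢ j × i ∈ S × j ∈ S
twoElements S 2≤|S| =
  element E first , element E second ,
  (λ eq → 0≢1 (FP.fromℕ<-injective 0 1 _ 2≤|S| (element-injective E first second eq))) ,
  element-∈ E first , element-∈ E second
  where
  E : Enumeration S (card S)
  E = enumerate S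
  first second : Fin (card S)
  first  = fromℕ< (NP.≤-trans (s≤s z≤n) 2≤|S|)
  second = fromℕ< 2≤|S|
  0≢1 : 0 ≢ 1
  0≢1 ()

Collision : ∀ {a N} → (Fin a → Fin N) → Set
Collision f = ∃₂ λ i j → i ≢ j × f i ≡ f j

splitAt-injective : ∀ a {b} {i j : Fin (a + b)} → splitAt a i ≡ splitAt a j → i ≡ j
splitAt-injective a {b} {i} {j} eq =
  trans (sym (FP.join-splitAt a b i)) (trans (cong (join a b) eq) (FP.join-splitAt a b j))

pigeonhole₂ : ∀ {a b N} → N < a + b → (f : Fin a → Fin N) (g : Fin b → Fin N) →
  Collision f ⊎ Collision g ⊎ ∃₂ λ p q → f p ≡ g q
pigeonhole₂ {a} N<a+b f g with FP.pigeonhole N<a+b ([ f , g ]′ ∘ splitAt a)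
... | i , j , i<j , hᵢ≡hⱼ = classify (splitAt a i) (splitAt a j) refl refl hᵢ≡hⱼ
  where
  distinct : ∀ {x y} → splitAt a i ≡ x → splitAt a j ≡ y → x ≢ y
  distinct eqᵢ eqⱼ x≡y = FP.<⇒≢ i<j (splitAt-injective a (trans eqᵢ (trans x≡y (sym eqⱼ))))

  classify : ∀ x y → splitAt a i ≡ x → splitAt a j ≡ y → [ f , g ]′ x ≡ [ f , g ]′ y →
             Collision f ⊎ Collision g ⊎ ∃₂ λ p q → f p ≡ g q
  classify (inj₁ p) (inj₁ q) eqᵢ eqⱼ fp≡fq = inj₁ (p , q , distinct eqᵢ eqⱼ ∘ cong inj₁ , fp≡fq)
  classify (inj₂ p) (inj₂ q) eqᵢ eqⱼ gp≡gq = inj₂ (inj₁ (p , q , distinct eqᵢ eqⱼ ∘ cong inj₂ , gp≡gq))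
  classify (inj₁ p) (inj₂ q) _   _   fp≡gq = inj₂ (inj₂ (p , q , fp≡gq))
  classify (inj₂ p) (inj₁ q) _   _   gp≡fq = inj₂ (inj₂ (q , p , sym gp≡fq))

CollisionIn : ∀ {m N} → Subset m → (Fin m → Fin N) → Set
CollisionIn S f = ∃₂ λ i j → i ≢ j × i ∈ S × j ∈ S × f i ≡ f j

pigeonhole-⊎ : ∀ {m N} (S₁ S₂ : Subset m) (f₁ f₂ : Fin m → Fin N) → N < card S₁ + card S₂ →
  CollisionIn S₁ f₁ ⊎ CollisionIn S₂ f₂ ⊎ ∃₂ λ i j → i ∈ S₁ × j ∈ S₂ × f₁ i ≡ f₂ j
pigeonhole-⊎ S₁ S₂ f₁ f₂ N<|S₁|+|S₂| =
  [ inj₁ ∘ within E₁ f₁ , [ inj₂ ∘ inj₁ ∘ within E₂ f₂ , inj₂ ∘ inj₂ ∘ across ]′ ]′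
    (pigeonhole₂ N<|S₁|+|S₂| (f₁ ∘ element E₁) (f₂ ∘ element E₂))
  where
  E₁ : Enumeration S₁ (card S₁)
  E₁ = enumerate S₁
  E₂ : Enumeration S₂ (card S₂)
  E₂ = enumerate S₂

  within : ∀ {S c} (E : Enumeration S c) f → Collision (f ∘ element E) → CollisionIn S f
  within E f (p , q , p≢q , eq) =
    element E p , element E q , p≢q ∘ element-injective E p q , element-∈ E p , element-∈ E q , eq

  across : (∃₂ λ p q → f₁ (element E₁ p) ≡ f₂ (element E₂ q)) → ∃₂ λ i j → i ∈ S₁ × j ∈ S₂ × f₁ i ≡ f₂ j
  across (p , q , eq) = element E₁ p , element E₂ q , element-∈ E₁ p , element-∈ E₂ q , eq

bit : Bool → Fin 2
bit false = zero
bit true  = suc zero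

bit-injective : ∀ {a b} → bit a ≡ bit b → a ≡ b
bit-injective {false} {false} _ = refl
bit-injective {true}  {true}  _ = refl

encode : ∀ {d} (c : List Bool) → length c ≡ d → Fin (2 ^ d)
encode {zero}  []      _   = zero
encode {suc d} (b ∷ c) len = combine (bit b) (encode c (NP.suc-injective len))

encode-injective : ∀ {d} (c c′ : List Bool) (len : length c ≡ d) (len′ : length c′ ≡ d) →
  encode c len ≡ encode c′ len′ → c ≡ c′
encode-injective {zero}  []      []        _   _    _  = refl
encode-injective {suc d} (b ∷ c) (b′ ∷ c′) len len′ eq
  with FP.combine-injective (bit b) (encode c (NP.suc-injective len))
                            (bit b′) (encode c′ (NP.suc-injective len′)) eq
... | bit≡ , rest≡ =
  cong₂ _∷_ (bit-injective bit≡) (encode-injective c c′ (NP.suc-injective len) (NP.suc-injective len′) rest≡)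

-- An element of the span of ws is coded by a coefficient list; equal codes
-- mean equal coefficients and hence equal vectors, so the span has at most
-- 2 ^ length ws elements.
spanCode : ∀ {n} (ws : List (F₂^ n)) {x} → InSpan ws x → Fin (2 ^ length ws)
spanCode ws (c , len , _) = encode c len

spanCode-injective : ∀ {n} (ws : List (F₂^ n)) {x y} (P : InSpan ws x) (Q : InSpan ws y) →
  spanCode ws P ≡ spanCode ws Q → x ≡ y
spanCode-injective ws (c , len , sum) (c′ , len′ , sum′) eq =
  trans (sym sum) (trans (cong (λ d → ΣL (L.zipWith (λ b w → if b then w else zeroV) d ws))
    (encode-injective c c′ len len′ eq)) sum′)

module _ {n m : ℕ} (v : Fin m → F₂^ n) where

  ZeroSum : Subset m → ℕ → Set
  ZeroSum R s = ∃[ Q ] Q ⊆ R × card Q ≡ s × ΣOver Q v ≡ zeroV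

  zeroSum-⊆ : ∀ {R R′ s} → R ⊆ R′ → ZeroSum R s → ZeroSum R′ s
  zeroSum-⊆ R⊆R′ (Q , Q⊆R , |Q| , ΣQ) = Q , (λ i → R⊆R′ i ∘ Q⊆R i) , |Q| , ΣQ

  equalSums : ∀ {R Q₁ Q₂ s₁ s₂} → Q₁ ⊆ R ∖ Q₂ → Q₂ ⊆ R → card Q₁ ≡ s₁ → card Q₂ ≡ s₂ →
    ΣOver Q₁ v ≡ ΣOver Q₂ v → ZeroSum R (s₁ + s₂)
  equalSums {R} {Q₁} {Q₂} Q₁⊆R∖Q₂ Q₂⊆R |Q₁| |Q₂| ΣQ₁≡ΣQ₂ =
    Q₁ ∪ Q₂ ,
    ∪-⊆ {S = Q₁} {Q₂} (λ i → ∖-⊆ {R = R} {Q₂} i ∘ Q₁⊆R∖Q₂ i) Q₂⊆R ,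
    trans (card-∪ {S = Q₁} {Q₂} disjoint) (cong₂ _+_ |Q₁| |Q₂|) ,
    trans (ΣOver-∪ {S = Q₁} {Q₂} v disjoint) (trans (cong (_⊕ ΣOver Q₂ v) ΣQ₁≡ΣQ₂) (⊕.inverseʳ (ΣOver Q₂ v)))
    where
    disjoint : Q₁ ⊆ ∁ Q₂
    disjoint i = ∖-⊆∁ {R = R} {Q₂} i ∘ Q₁⊆R∖Q₂ i

  equalPair : ∀ {R i j} → i ≢ j → i ∈ R → j ∈ R → v i ≡ v j → ZeroSum R 2
  equalPair {R} {i} {j} i≢j i∈R j∈R vi≡vj =
    pair i j , pair-⊆ {i = i} {j} {R} i∈R j∈R , card-pair i≢j ,
    trans (ΣOver-pair v i≢j) (trans (cong (_⊕ v j) vi≡vj) (⊕.inverseʳ (v j)))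

  Distinct : Subset m → Set
  Distinct D = ∀ i j → i ∈ D → j ∈ D → v i ≡ v j → i ≡ j

  equalPairOrDistinct : (R : Subset m) → ZeroSum R 2 ⊎ Distinct R
  equalPairOrDistinct R with FP.any? (λ i → FP.any? (λ j →
    ¬? (i ≟ j) ×-dec T? (R i) ×-dec T? (R j) ×-dec VP.≡-dec BP._≟_ (v i) (v j)))
  ... | yes (i , j , i≢j , i∈R , j∈R , vi≡vj) = inj₁ (equalPair i≢j i∈R j∈R vi≡vj)
  ... | no noEqualPair = inj₂ λ i j i∈R j∈R vi≡vj →
    decidable-stable (i ≟ j) λ i≢j → noEqualPair (i , j , i≢j , i∈R , j∈R , vi≡vj)

-- The combinatorial core, for m vectors whose subset sums all lie in the span of
-- a list ws with 2 ^ length ws ≤ m: subsets of indices are coded injectively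
-- (up to their sums) by numbers below N = 2 ^ length ws ≤ m.
module HalfSums {n m : ℕ} (v : Fin m → F₂^ n) (ws : List (F₂^ n))
  (spans : (x : F₂^ n) → (∃[ S ] ΣOver S v ≡ x) → InSpan ws x) (N≤m : 2 ^ length ws ≤ m) where

  N : ℕ
  N = 2 ^ length ws

  code : Subset m → Fin N
  code S = spanCode ws (spans (ΣOver S v) (S , refl))

  code-injective : ∀ S R → code S ≡ code R → ΣOver S v ≡ ΣOver R v
  code-injective S R = spanCode-injective ws (spans _ (S , refl)) (spans _ (R , refl))

  code-⁅⁆-injective : ∀ {i j} → code ⁅ i ⁆ ≡ code ⁅ j ⁆ → v i ≡ v j
  code-⁅⁆-injective {i} {j} eq =
    trans (sym (ΣOver-⁅⁆ v i)) (trans (code-injective ⁅ i ⁆ ⁅ j ⁆ eq) (ΣOver-⁅⁆ v j))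

  -- The m + 1 sums 0, v₁, …, v_m take at most m values; as no vᵢ is 0, two vᵢ coincide.
  equalPairAmongNonzero : (∀ i → v i ≢ zeroV) → ZeroSum v full 2
  equalPairAmongNonzero nonzero with pigeonhole₂ (s≤s N≤m) (λ (_ : Fin 1) → code ∅) (λ i → code ⁅ i ⁆)
  ... | inj₁ (zero , zero , 0≢0 , _)   = ⊥-elim (0≢0 refl)
  ... | inj₂ (inj₁ (i , j , i≢j , eq)) = equalPair v i≢j _ _ (code-⁅⁆-injective eq)
  ... | inj₂ (inj₂ (zero , i , eq))    =
    ⊥-elim (nonzero i (trans (sym (ΣOver-⁅⁆ v i)) (trans (sym (code-injective ∅ ⁅ i ⁆ eq)) (ΣOver-∅ v))))

  module _ {k : ℕ} (m≡k+k : m ≡ k + k) where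

    module _ (D : Subset m) (distinct : Distinct v D) (big : k + 2 ≤ card D)
             {x y : Fin m} (x≢y : x ≢ y) (x∈D : x ∈ D) (y∈D : y ∈ D) where

      P : Subset m
      P = pair x y

      D′ : Subset m
      D′ = D ∖ P

      t : F₂^ n
      t = v x ⊕ v y

      shifted : Fin m → Subset m
      shifted j = ⁅ j ⁆ ∪ P

      ΣOver-shifted : ∀ j → j ∈ ∁ P → ΣOver (shifted j) v ≡ v j ⊕ t
      ΣOver-shifted j j∉P =
        trans (ΣOver-∪ {S = ⁅ j ⁆} {P} v (λ l l∈⁅j⁆ → subst (_∈ ∁ P) (sym (∈-⁅⁆ j l l∈⁅j⁆)) j∉P))
              (cong₂ _⊕_ (ΣOver-⁅⁆ v j) (ΣOver-pair v x≢y))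

      ∉P⇒≢ : ∀ {j} → j ∈ ∁ P → j ≢ x × j ≢ y
      ∉P⇒≢ {j} j∉P = (λ j≡x → ∈∁⇒∉ P j j∉P (subst (_∈ P) (sym j≡x) (pair-∋ˡ x y)))
                   , (λ j≡y → ∈∁⇒∉ P j j∉P (subst (_∈ P) (sym j≡y) (pair-∋ʳ x y)))

      |D′|+2≡|D| : card D′ + 2 ≡ card D
      |D′|+2≡|D| = trans (cong (card D′ +_) (sym (card-pair x≢y)))
                         (card-∖ {S = P} {D} (pair-⊆ {i = x} {y} {D} x∈D y∈D))

      -- there are more pigeons (D and D′) than values (at most 2k)
      N<|D|+|D′| : N < card D + card D′
      N<|D|+|D′| = NP.≤-<-trans (subst (N ≤_) m≡k+k N≤m) (NP.+-mono-<-≤ k<|D| k≤|D′|)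
        where
        k<|D| : k < card D
        k<|D| = NP.<-≤-trans (NP.m<m+n k (s≤s z≤n)) big
        k≤|D′| : k ≤ card D′
        k≤|D′| = NP.+-cancelʳ-≤ 2 k (card D′) (subst (k + 2 ≤_) (sym |D′|+2≡|D|) big)

      shifted-injective : ∀ {i j} → i ∈ D′ → j ∈ D′ → code (shifted i) ≡ code (shifted j) → v i ≡ v j
      shifted-injective {i} {j} i∈D′ j∈D′ eq = ⊕.∙-cancelʳ t (v i) (v j) (begin
        v i ⊕ t               ≡⟨ ΣOver-shifted i (∖-⊆∁ {R = D} {P} i i∈D′) ⟨
        ΣOver (shifted i) v   ≡⟨ code-injective (shifted i) (shifted j) eq ⟩
        ΣOver (shifted j) v   ≡⟨ ΣOver-shifted j (∖-⊆∁ {R = D} {P} j j∈D′) ⟩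
        v j ⊕ t               ∎)
        where open ≡-Reasoning

      crossCollision : ∀ {i j} → i ∈ D → j ∈ D′ → v i ≡ v j ⊕ t → ZeroSum v D 4
      crossCollision {i} {j} i∈D j∈D′ vi≡vj+t =
        equalSums v {D} {pair i j} {P} (pair-⊆ {i = i} {j} {D′} i∈D′ j∈D′) (pair-⊆ {i = x} {y} {D} x∈D y∈D)
          (card-pair i≢j) (card-pair x≢y)
          (trans (ΣOver-pair v i≢j) (trans (⊕-solve vi≡vj+t) (sym (ΣOver-pair v x≢y))))
        where
        j∈D : j ∈ D
        j∈D = ∖-⊆ {R = D} {P} j j∈D′
        j≢x : j ≢ x
        j≢x = proj₁ (∉P⇒≢ (∖-⊆∁ {R = D} {P} j j∈D′))
        j≢y : j ≢ y
        j≢y = proj₂ (∉P⇒≢ (∖-⊆∁ {R = D} {P} j j∈D′))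
        at : ∀ {l} → i ≡ l → v l ≡ v j ⊕ t
        at i≡l = subst (λ l → v l ≡ v j ⊕ t) i≡l vi≡vj+t
        -- v x = v j + v x + v y would force v j = v y
        i≢x : i ≢ x
        i≢x i≡x = j≢y (distinct j y j∈D y∈D (⊕.∙-cancelˡ (v x) (v j) (v y) (⊕-solve (at i≡x))))
        -- v y = v j + v x + v y would force v j = v x
        i≢y : i ≢ y
        i≢y i≡y = j≢x (distinct j x j∈D x∈D
          (⊕.∙-cancelˡ (v y) (v j) (v x) (trans (⊕-solve (at i≡y)) (⊕.comm (v x) (v y)))))
        -- v j = v j + t would force t = 0, i.e. v x = v y
        i≢j : i ≢ j
        i≢j i≡j = x≢y (distinct x y x∈D y∈D (⊕.uniqueˡ-⁻¹ (v x) (v y)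
          (trans (sym (⊕-solve (at i≡j))) (⊕.inverseʳ (v j)))))
        i∈D′ : i ∈ D′
        i∈D′ = ∈-∖ {R = D} {P} i∈D (pair-∌ x y i i≢x i≢y)

      -- Collisions inside D or inside D′ contradict injectivity, so the pigeonhole
      -- principle yields a cross collision.
      quadrupleThrough : ZeroSum v D 4
      quadrupleThrough with pigeonhole-⊎ D D′ (λ i → code ⁅ i ⁆) (λ j → code (shifted j)) N<|D|+|D′|
      ... | inj₁ (i , j , i≢j , i∈D , j∈D , eq) = ⊥-elim (i≢j (distinct i j i∈D j∈D (code-⁅⁆-injective eq)))
      ... | inj₂ (inj₁ (i , j , i≢j , i∈D′ , j∈D′ , eq)) =
        ⊥-elim (i≢j (distinct i j (∖-⊆ {R = D} {P} i i∈D′) (∖-⊆ {R = D} {P} j j∈D′)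
                              (shifted-injective i∈D′ j∈D′ eq)))
      ... | inj₂ (inj₂ (i , j , i∈D , j∈D′ , eq)) = crossCollision i∈D j∈D′
        (trans (sym (ΣOver-⁅⁆ v i))
               (trans (code-injective ⁅ i ⁆ (shifted j) eq) (ΣOver-shifted j (∖-⊆∁ {R = D} {P} j j∈D′))))

    distinctQuadruple : (D : Subset m) → Distinct v D → k + 2 ≤ card D → ZeroSum v D 4
    distinctQuadruple D distinct big with twoElements D (NP.≤-trans (NP.m≤n+m 2 k) big)
    ... | x , y , x≢y , x∈D , y∈D = quadrupleThrough D distinct big x≢y x∈D y∈D

    -- Every set of at least k + 4 indices has a zero-sum quadruple: two disjoint
    -- equal pairs, or else one equal pair is removed and v is injective on the rest.
    quadruple : (R : Subset m) → k + 4 ≤ card R → ZeroSum v R 4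
    quadruple R big with equalPairOrDistinct v R
    ... | inj₂ distinct = distinctQuadruple R distinct (NP.≤-trans (NP.+-monoʳ-≤ k (NP.m≤m+n 2 2)) big)
    ... | inj₁ (Q , Q⊆R , |Q|≡2 , ΣQ≡0) with equalPairOrDistinct v (R ∖ Q)
    ...   | inj₁ (Q′ , Q′⊆R∖Q , |Q′|≡2 , ΣQ′≡0) = equalSums v Q′⊆R∖Q Q⊆R |Q′|≡2 |Q|≡2 (trans ΣQ′≡0 (sym ΣQ≡0))
    ...   | inj₂ distinct′ = zeroSum-⊆ v (∖-⊆ {R = R} {Q}) (distinctQuadruple (R ∖ Q) distinct′ big′)
      where
      big′ : k + 2 ≤ card (R ∖ Q)
      big′ = NP.+-cancelʳ-≤ 2 (k + 2) (card (R ∖ Q)) (begin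
        k + 2 + 2             ≡⟨ NP.+-assoc k 2 2 ⟩
        k + 4                 ≤⟨ big ⟩
        card R                ≡⟨ card-∖ {S = Q} {R} Q⊆R ⟨
        card (R ∖ Q) + card Q ≡⟨ cong (card (R ∖ Q) +_) |Q|≡2 ⟩
        card (R ∖ Q) + 2      ∎)
        where open NP.≤-Reasoning

    complementRoom : ∀ {A : Subset m} j → card A ≡ 4 * j → 4 * suc j ≤ k → k + 4 ≤ card (∁ A)
    complementRoom {A} j |A|≡4j 4[1+j]≤k = NP.+-cancelʳ-≤ (4 * j) (k + 4) (card (∁ A)) (begin
      k + 4 + 4 * j       ≡⟨ NP.+-assoc k 4 (4 * j) ⟩
      k + (4 + 4 * j)     ≡⟨ cong (k +_) (NP.*-suc 4 j) ⟨
      k + 4 * suc j       ≤⟨ NP.+-monoʳ-≤ k 4[1+j]≤k ⟩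
      k + k               ≡⟨ m≡k+k ⟨
      m                   ≡⟨ card-∁ A ⟨
      card (∁ A) + card A ≡⟨ cong (card (∁ A) +_) |A|≡4j ⟩
      card (∁ A) + 4 * j  ∎)
      where open NP.≤-Reasoning

    multipleOf4 : ∀ j → 4 * j ≤ k → ZeroSum v full (4 * j)
    multipleOf4 zero    _ = ∅ , (λ _ _ → _) , card-∅ {m} , ΣOver-∅ v
    multipleOf4 (suc j) 4[1+j]≤k with multipleOf4 j (NP.≤-trans (NP.*-monoʳ-≤ 4 (NP.n≤1+n j)) 4[1+j]≤k)
    ... | A , _ , |A|≡4j , ΣA≡0 with quadruple (∁ A) (complementRoom j |A|≡4j 4[1+j]≤k)
    ...   | Q , Q⊆∁A , |Q|≡4 , ΣQ≡0 = subst (ZeroSum v full) (sym (NP.*-suc 4 j))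
      (equalSums v Q⊆∁A (λ _ _ → _) |Q|≡4 |A|≡4j (trans ΣQ≡0 (sym ΣA≡0)))

2^[1+n]≡2^n+2^n : ∀ n → 2 ^ suc n ≡ 2 ^ n + 2 ^ n
2^[1+n]≡2^n+2^n n = cong (2 ^ n +_) (NP.+-identityʳ (2 ^ n))

-- A zero-sum set of 2^(n-2) indices, for n = n′ + 3: a pair when n = 3, and
-- 2^(n-4) quadruples when n ≥ 4.  The span has at most 2^(n-1) = m elements.
halfZeroSum : ∀ n′ (v : Fin (2 ^ suc (suc n′)) → F₂^ (suc (suc (suc n′)))) →
  (∀ i → v i ≢ zeroV) → DimSpan< v (suc (suc (suc n′))) → ZeroSum v full (2 ^ suc n′)
halfZeroSum zero v nonzero (ws , |ws|<3 , spans , _) = equalPairAmongNonzero nonzero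
  where open HalfSums v ws spans (NP.^-monoʳ-≤ 2 (NP.≤-pred |ws|<3))
halfZeroSum (suc p) v nonzero (ws , |ws|<n , spans , _) =
  subst (ZeroSum v full) 4·2ᵖ≡k (multipleOf4 (2^[1+n]≡2^n+2^n (suc (suc p))) (2 ^ p) (NP.≤-reflexive 4·2ᵖ≡k))
  where
  open HalfSums v ws spans (NP.^-monoʳ-≤ 2 (NP.≤-pred |ws|<n))
  4·2ᵖ≡k : 4 * 2 ^ p ≡ 2 ^ suc (suc p)
  4·2ᵖ≡k = NP.*-assoc 2 2 (2 ^ p)

complement-card : ∀ {m k} (A : Subset m) → m ≡ k + k → card A ≡ k → card (∁ A) ≡ k
complement-card {k = k} A m≡k+k |A|≡k =
  NP.+-cancelʳ-≡ k (card (∁ A)) k (trans (cong (card (∁ A) +_) (sym |A|≡k)) (trans (card-∁ A) m≡k+k))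

complement-sum : ∀ {n m} (A : Subset m) (v : Fin m → F₂^ n) → Σᵥ v ≡ zeroV → ΣOver A v ≡ zeroV →
  ΣOver (∁ A) v ≡ zeroV
complement-sum A v total ΣA≡0 =
  trans (sym (⊕.identityʳ _)) (trans (cong (ΣOver (∁ A) v ⊕_) (sym ΣA≡0)) (trans (ΣOver-∁ A v) total))

lemma3 : (n : ℕ) → 3 ≤ n → (v : Fin (2 ^ (n ∸ 1)) → F₂^ n) →
    (∀ i → v i ≢ zeroV) → Σᵥ v ≡ zeroV → DimSpan< v n →
    ∃[ A ] (card A ≡ 2 ^ (n ∸ 2)) × (card (λ i → not (A i)) ≡ 2 ^ (n ∸ 2)) ×
      (ΣOver A v ≡ zeroV) × (ΣOver (λ i → not (A i)) v ≡ zeroV)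
lemma3 0             ()
lemma3 1             (s≤s ())
lemma3 2             (s≤s (s≤s ()))
lemma3 (suc (suc (suc n′))) _ v nonzero total dim with halfZeroSum n′ v nonzero dim
... | A , _ , |A|≡k , ΣA≡0 =
  A , |A|≡k , complement-card A (2^[1+n]≡2^n+2^n (suc n′)) |A|≡k , ΣA≡0 , complement-sum A v total ΣA≡0
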